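{- Let $\sigma$ be a primitive substitution defined on an alphabet with $d$ letters. Then $R_\sigma\le 2|\sigma|^{(d-1)d^d}$.
   Context: A substitution $\sigma:A^*\to A^*$ is primitive if its incidence matrix (entry $(i,j)$ = number of occurrences of $i$ in $\sigma(j)$) has a power with strictly positive entries. $|\sigma|=\max_{b\in A}|\sigma(b)|$. $R_\sigma$ denotes the maximal difference between two successive occurrences of a word of length $2$ in any fixed point of $\sigma$. -}

module Defs where

open import Data.Nat using (ℕ; zero; suc; _+_; _*_; _<_; _⊔_)
open import Data.Fin using (Fin; _≟_)
open import Data.List using (List; length; concatMap; applyUpTo; tabulate; foldr; filter)
open import Data.Nat.ListAction using (sum)
open import Data.Product using (∃; _×_)
open import Relation.Binary.PropositionalEquality using (_≡_)
open import Relation.Nullary using (yes; no)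

Subst : ℕ → Set
Subst d = Fin d → List (Fin d)

apply : ∀ {d} → Subst d → List (Fin d) → List (Fin d)
apply σ = concatMap σ

Matrix : ℕ → Set
Matrix d = Fin d → Fin d → ℕ

incidence : ∀ {d} → Subst d → Matrix d
incidence σ i j = length (filter (_≟ i) (σ j))

idMat : ∀ {d} → Matrix d
idMat i j with i ≟ j
... | yes _ = 1
... | no _ = 0

mulMat : ∀ {d} → Matrix d → Matrix d → Matrix d
mulMat M N i j = sum (tabulate (λ k → M i k * N k j))

powMat : ∀ {d} → Matrix d → ℕ → Matrix d
powMat M zero = idMat
powMat M (suc k) = mulMat M (powMat M k)

Primitive : ∀ {d} → Subst d → Set
Primitive σ = ∃ λ k → ∀ i j → 0 < powMat (incidence σ) (suc k) i j

size : ∀ {d} → Subst d → ℕ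
size σ = foldr _⊔_ 0 (tabulate (λ b → length (σ b)))

InfWord : ℕ → Set
InfWord d = ℕ → Fin d

pref : ∀ {d} → InfWord d → ℕ → List (Fin d)
pref x n = applyUpTo x n

-- x is a fixed point of σ: σ(x) = x, i.e. the image of every prefix of x
-- is a prefix of x (σ is non-erasing when primitive, so this determines σ(x))
FixedPoint : ∀ {d} → Subst d → InfWord d → Set
FixedPoint σ x = ∀ n → apply σ (pref x n) ≡ pref x (length (apply σ (pref x n)))

OccursAt : ∀ {d} → InfWord d → Fin d → Fin d → ℕ → Set
OccursAt x a b i = (x i ≡ a) × (x (suc i) ≡ b)

-- Every σ^(2^d∸2)(c) contains all letters: the set of letters of σⁿ(c) determines that of σⁿ⁺¹(c),
-- is never empty, and is eventually full by primitivity.  A digram of the fixed point x occurs in some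
-- σⁿ(x 0), so it arises from a digram inside some σ(e) by repeatedly passing to the digram across the
-- junction σ(y)σ(z), i.e. (y , z) ↦ (last σ(y) , first σ(z)); these junction digrams cycle within d * d
-- pairs.  Hence the digram occurs in σ^N(c) for every letter c, with N ≤ d * d + 2^d ∸ 2, which is at
-- most (d ∸ 1) * d ^ d for d ≥ 3 (for d = 2 one gets N = 4 directly, using that maps Fin 2 → Fin 2
-- satisfy g³ = g).  Cutting x = σ^N(x) into the blocks σ^N(x m), each of length at most |σ|^N and each
-- containing the digram, successive occurrences are at most 2 |σ|^N apart.

module Submission where

open import Defs
open import Data.Nat using (ℕ; _<_; _≤_; _∸_; _*_; _^_)
open import Data.Fin using (Fin)
open import Relation.Nullary using (¬_)

open import Data.Nat.Base using (zero; suc; _+_; _⊔_; z≤n; s≤s)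
open import Data.Nat.Properties hiding (_≟_)
open import Data.Nat.GeneralisedArithmetic using (fold; fold-+)
open import Data.Nat.Induction using (<-rec)
open import Data.Fin.Base as Fin using (toℕ; combine; punchOut; cast; funToFin; finToFun)
open import Data.Fin.Properties
  using (_≟_; pigeonhole; toℕ≤pred[n]; punchOut-injective; punchOut-cong; combine-injective;
         toℕ-injective; toℕ-cast; finToFun-funToFin)
open import Data.List.Base
  using (List; []; _∷_; _++_; [_]; _∷ʳ_; length; filter; tabulate; foldr; initLast; _∷ʳ′_)
open import Data.Nat.ListAction using (sum)
open import Data.List.Properties
  using (++-assoc; ++-identityʳ; length-++; concatMap-++; ∷-injective; ∷ʳ-injectiveʳ; applyUpTo-∷ʳ;
         length-applyUpTo)
open import Data.List.Membership.Propositional using (_∈_; find; lose)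
open import Data.List.Membership.Propositional.Properties using (∈-++⁺ʳ; ∈-∃++; ∉[])
import Data.List.Membership.DecPropositional as DecMembership
open import Data.List.Relation.Unary.Any using (here; there)
import Data.List.Relation.Unary.Any.Properties as Any
open import Data.List.Relation.Binary.Subset.Propositional using (_⊆_)
import Data.List.Relation.Binary.Subset.Propositional.Properties as ⊆
open import Data.Product using (∃; ∃₂; _×_; _,_; proj₁; proj₂; map₂)
open import Data.Sum using (_⊎_; inj₁; inj₂)
open import Data.Empty using (⊥-elim)
open import Function.Base using (_∘_)
open import Relation.Binary.PropositionalEquality
  using (_≡_; _≢_; _≗_; refl; sym; trans; cong; cong₂; subst; subst₂; module ≡-Reasoning)
open import Relation.Nullary using (Dec; yes; no)

infixr 9 _^[_]_

_^[_]_ : ∀ {A : Set} → (A → A) → ℕ → A → A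
f ^[ n ] x = fold x f n

^[+] : ∀ {A : Set} (f : A → A) m n x → f ^[ m + n ] x ≡ f ^[ m ] (f ^[ n ] x)
^[+] f m n x = fold-+ x f m

^[suc]-of-cubic : ∀ {A : Set} (f : A → A) → (∀ x → f (f (f x)) ≡ f x) →
  ∀ t x → f ^[ suc t ] x ≡ f x ⊎ f ^[ suc t ] x ≡ f (f x)
^[suc]-of-cubic f cubic zero x = inj₁ refl
^[suc]-of-cubic f cubic (suc t) x with ^[suc]-of-cubic f cubic t x
... | inj₁ eq = inj₂ (cong f eq)
... | inj₂ eq = inj₁ (trans (cong f eq) (cubic x))

module _ {s : ℕ} (κ : ℕ → Fin s) (κ-step : ∀ {i j} → κ i ≡ κ j → κ (suc i) ≡ κ (suc j)) where

  κ-shift : ∀ r {i j} → κ i ≡ κ j → κ (r + i) ≡ κ (r + j)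
  κ-shift zero eq = eq
  κ-shift (suc r) eq = κ-step (κ-shift r eq)

  -- Pigeonhole among κ 0 … κ s gives κ i ≡ κ j with i < j ≤ s; any later time steps back by j ∸ i.
  attained-before : ∀ t → ∃ λ t′ → t′ < s × κ t′ ≡ κ t
  attained-before = <-rec _ go
    where
    go : ∀ t → (∀ {t′} → t′ < t → ∃ λ t″ → t″ < s × κ t″ ≡ κ t′) → ∃ λ t′ → t′ < s × κ t′ ≡ κ t
    go t rec with t <? s
    ... | yes t<s = t , t<s , refl
    ... | no t≮s = step-back (pigeonhole (n<1+n s) (κ ∘ toℕ))
      where
      step-back : (∃₂ λ i j → i Fin.< j × κ (toℕ i) ≡ κ (toℕ j)) → ∃ λ t′ → t′ < s × κ t′ ≡ κ t
      step-back (i , j , i<j , κi≡κj) =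
        map₂ (map₂ (λ eq → trans eq (trans (κ-shift r κi≡κj) (cong κ j+r≡t))))
             (rec (≤-trans (+-monoʳ-< r i<j) (≤-reflexive j+r≡t)))
        where
        r = t ∸ toℕ j
        j+r≡t : r + toℕ j ≡ t
        j+r≡t = m∸n+n≡m (≤-trans (toℕ≤pred[n] j) (≮⇒≥ t≮s))

attained-before-avoiding : ∀ {s} (κ : ℕ → Fin (suc s)) (z : Fin (suc s)) → (∀ n → z ≢ κ n) →
  (∀ {i j} → κ i ≡ κ j → κ (suc i) ≡ κ (suc j)) → ∀ t → ∃ λ t′ → t′ < s × κ t′ ≡ κ t
attained-before-avoiding κ z z≢κ κ-step t =
  map₂ (map₂ (punchOut-injective (z≢κ _) (z≢κ _))) (attained-before κ′ κ′-step t)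
  where
  κ′ = λ n → punchOut (z≢κ n)
  κ′-step : ∀ {i j} → κ′ i ≡ κ′ j → κ′ (suc i) ≡ κ′ (suc j)
  κ′-step eq = punchOut-cong z (κ-step (punchOut-injective (z≢κ _) (z≢κ _) eq))

Adjacent : ∀ {A : Set} → A × A → List A → Set
Adjacent p w = ∃₂ λ u v → w ≡ u ++ proj₁ p ∷ proj₂ p ∷ v

module _ {A : Set} where

  Adjacent-++⁺ˡ : ∀ {p : A × A} {u} v → Adjacent p u → Adjacent p (u ++ v)
  Adjacent-++⁺ˡ v (u′ , v′ , refl) = u′ , v′ ++ v , ++-assoc u′ _ v

  Adjacent-++⁺ʳ : ∀ {p : A × A} u {v} → Adjacent p v → Adjacent p (u ++ v)
  Adjacent-++⁺ʳ u (u′ , v′ , refl) = u ++ u′ , v′ , sym (++-assoc u u′ _)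

  Adjacent⇒2≤length : ∀ {p : A × A} {w} → Adjacent p w → 2 ≤ length w
  Adjacent⇒2≤length (u , v , refl) =
    ≤-trans (s≤s (s≤s z≤n)) (subst (suc (suc (length v)) ≤_) (sym (length-++ u)) (m≤n+m _ (length u)))

  Adjacent⇒∈ : ∀ {a b : A} {w} → Adjacent (a , b) w → a ∈ w × b ∈ w
  Adjacent⇒∈ (u , v , refl) = ∈-++⁺ʳ u (here refl) , ∈-++⁺ʳ u (there (here refl))

  Adjacent-++⁻ : ∀ {a b : A} u {v} → Adjacent (a , b) (u ++ v) →
    Adjacent (a , b) u ⊎ Adjacent (a , b) v ⊎ (∃ λ u′ → u ≡ u′ ∷ʳ a) × (∃ λ v′ → v ≡ b ∷ v′)
  Adjacent-++⁻ [] adj = inj₂ (inj₁ adj)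
  Adjacent-++⁻ (x ∷ []) ([] , v′ , eq) with ∷-injective eq
  ... | refl , eq′ = inj₂ (inj₂ (([] , refl) , (v′ , eq′)))
  Adjacent-++⁻ (x ∷ y ∷ u) ([] , v′ , eq) with ∷-injective eq
  ... | refl , eq′ with ∷-injective eq′
  ... | refl , _ = inj₁ ([] , u , refl)
  Adjacent-++⁻ (x ∷ u) (_ ∷ u′ , v′ , eq) with Adjacent-++⁻ u (u′ , v′ , proj₂ (∷-injective eq))
  ... | inj₁ adj = inj₁ (Adjacent-++⁺ʳ [ x ] adj)
  ... | inj₂ (inj₁ adj) = inj₂ (inj₁ adj)
  ... | inj₂ (inj₂ ((u″ , refl) , v-split)) = inj₂ (inj₂ ((x ∷ u″ , refl) , v-split))

sum-tabulate-pos⇒pos : ∀ {n} (f : Fin n → ℕ) → 0 < sum (tabulate f) → ∃ λ k → 0 < f k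
sum-tabulate-pos⇒pos {suc n} f pos with f Fin.zero in f0≡
... | suc _ = Fin.zero , subst (0 <_) (sym f0≡) (s≤s z≤n)
... | zero with k , pos′ ← sum-tabulate-pos⇒pos (f ∘ Fin.suc) pos = Fin.suc k , pos′

*-pos⇒pos : ∀ m n → 0 < m * n → 0 < m × 0 < n
*-pos⇒pos (suc m) (suc n) _ = s≤s z≤n , s≤s z≤n
*-pos⇒pos (suc m) zero pos = ⊥-elim (<-irrefl refl (subst (0 <_) (*-zeroʳ (suc m)) pos))

count-pos⇒∈ : ∀ {d} {e : Fin d} w → 0 < length (filter (_≟ e) w) → e ∈ w
count-pos⇒∈ {e = e} (y ∷ w) pos with y ≟ e
... | yes refl = here refl
... | no _ = there (count-pos⇒∈ w pos)

idMat-pos⇒≡ : ∀ {d} (e c : Fin d) → 0 < idMat e c → e ≡ c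
idMat-pos⇒≡ e c pos with e ≟ c | pos
... | yes e≡c | _ = e≡c

other-letter : ∀ {n} (y : Fin (suc (suc n))) → ∃ λ e → e ≢ y
other-letter Fin.zero = Fin.suc Fin.zero , λ ()
other-letter (Fin.suc _) = Fin.zero , λ ()

Fin1-unique : ∀ (y z : Fin 1) → y ≡ z
Fin1-unique Fin.zero Fin.zero = refl

Fin2-≢-unique : ∀ {e y z : Fin 2} → y ≢ e → z ≢ e → y ≡ z
Fin2-≢-unique {Fin.zero} {Fin.zero} y≢e _ = ⊥-elim (y≢e refl)
Fin2-≢-unique {Fin.zero} {Fin.suc Fin.zero} {Fin.zero} _ z≢e = ⊥-elim (z≢e refl)
Fin2-≢-unique {Fin.zero} {Fin.suc Fin.zero} {Fin.suc Fin.zero} _ _ = refl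
Fin2-≢-unique {Fin.suc Fin.zero} {Fin.zero} {Fin.zero} _ _ = refl
Fin2-≢-unique {Fin.suc Fin.zero} {Fin.zero} {Fin.suc Fin.zero} _ z≢e = ⊥-elim (z≢e refl)
Fin2-≢-unique {Fin.suc Fin.zero} {Fin.suc Fin.zero} y≢e _ = ⊥-elim (y≢e refl)

Fin2-g∘g-fixes-image : ∀ (g : Fin 2 → Fin 2) {y z} → g z ≡ y → g (g y) ≡ y
Fin2-g∘g-fixes-image g {y} {z} gz≡y with g y ≟ y
... | yes gy≡y = trans (cong g gy≡y) gy≡y
... | no gy≢y = trans (cong g (Fin2-≢-unique gy≢y z≢y)) gz≡y
  where
  z≢y : z ≢ y
  z≢y refl = gy≢y gz≡y

pairCode : ∀ {m n} → Fin m × Fin n → Fin (m * n)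
pairCode (a , b) = combine a b

pairCode-injective : ∀ {m n} {p q : Fin m × Fin n} → pairCode p ≡ pairCode q → p ≡ q
pairCode-injective {p = a , b} {a′ , b′} eq with refl , refl ← combine-injective a b a′ b′ eq = refl

interval-containing : (B : ℕ → ℕ) → B 0 ≡ 0 → (∀ m → B m < B (suc m)) →
  ∀ i → ∃ λ m → B m ≤ i × i < B (suc m)
interval-containing B B0≡0 B-< zero = 0 , ≤-reflexive B0≡0 , subst (_< B 1) B0≡0 (B-< 0)
interval-containing B B0≡0 B-< (suc i) with interval-containing B B0≡0 B-< i
... | m , Bm≤i , i<Bm+1 with suc i <? B (suc m)
...   | yes i+1<Bm+1 = m , m≤n⇒m≤1+n Bm≤i , i+1<Bm+1
...   | no i+1≮Bm+1 = suc m , ≮⇒≥ i+1≮Bm+1 , ≤-<-trans i<Bm+1 (B-< (suc m))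

^-monoʳ-≤-from-2≤ : ∀ m {n o} → 2 ≤ m ^ n → n ≤ o → m ^ n ≤ m ^ o
^-monoʳ-≤-from-2≤ (suc m) _ n≤o = ^-monoʳ-≤ (suc m) n≤o
^-monoʳ-≤-from-2≤ zero {suc n} ()
^-monoʳ-≤-from-2≤ zero {zero} (s≤s ())

≤-foldr-⊔-tabulate : ∀ {n} (g : Fin n → ℕ) i → g i ≤ foldr _⊔_ 0 (tabulate g)
≤-foldr-⊔-tabulate g Fin.zero = m≤m⊔n (g Fin.zero) _
≤-foldr-⊔-tabulate g (Fin.suc i) = ≤-trans (≤-foldr-⊔-tabulate (g ∘ Fin.suc) i) (m≤n⊔m (g Fin.zero) _)

pref-suc : ∀ {d} (x : InfWord d) m → pref x (suc m) ≡ pref x m ++ [ x m ]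
pref-suc x m = sym (applyUpTo-∷ʳ x m)

Adjacent-pref : ∀ {d} (x : InfWord d) i {M} → suc (suc i) ≤ M → Adjacent (x i , x (suc i)) (pref x M)
Adjacent-pref x zero {suc (suc M)} _ = [] , _ , refl
Adjacent-pref x zero {suc zero} (s≤s ())
Adjacent-pref x (suc i) {suc M} (s≤s i+2≤M) = Adjacent-++⁺ʳ [ x 0 ] (Adjacent-pref (x ∘ suc) i i+2≤M)

pref≡⇒OccursAt : ∀ {d} (x : InfWord d) {M a b} u {v} →
  pref x M ≡ u ++ a ∷ b ∷ v → OccursAt x a b (length u)
pref≡⇒OccursAt x {suc (suc M)} [] eq =
  proj₁ (∷-injective eq) , proj₁ (∷-injective (proj₂ (∷-injective eq)))
pref≡⇒OccursAt x {suc M} (_ ∷ u) eq = pref≡⇒OccursAt (x ∘ suc) u (proj₂ (∷-injective eq))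

indicator : ∀ {P : Set} → Dec P → Fin 2
indicator (yes _) = Fin.suc Fin.zero
indicator (no _) = Fin.zero

indicator-≡⇒ : ∀ {P Q : Set} (p? : Dec P) (q? : Dec Q) → indicator p? ≡ indicator q? → P → Q
indicator-≡⇒ _ (yes q) _ _ = q
indicator-≡⇒ (no ¬p) (no _) _ p = ⊥-elim (¬p p)

indicator-cong : ∀ {P Q : Set} (p? : Dec P) (q? : Dec Q) → (P → Q) → (Q → P) →
  indicator p? ≡ indicator q?
indicator-cong (yes _) (yes _) _ _ = refl
indicator-cong (no _) (no _) _ _ = refl
indicator-cong (yes p) (no ¬q) p⇒q _ = ⊥-elim (¬q (p⇒q p))
indicator-cong (no ¬p) (yes q) _ q⇒p = ⊥-elim (¬p (q⇒p q))

funToFin-cong : ∀ {m n} {f g : Fin m → Fin n} → f ≗ g → funToFin f ≡ funToFin g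
funToFin-cong {zero} _ = refl
funToFin-cong {suc m} f≗g = cong₂ combine (f≗g Fin.zero) (funToFin-cong (f≗g ∘ Fin.suc))

module _ {d : ℕ} where
  open DecMembership (_≟_ {d}) using (_∈?_)

  -- The set of letters of a word, as a number below 2 ^ d; the cast exposes 2 ^ d as a successor
  -- so that the code of the empty word can be punched out.
  supportCode : List (Fin d) → Fin (suc (2 ^ d ∸ 1))
  supportCode w = cast (sym (suc-pred (2 ^ d) {{m^n≢0 2 d}})) (funToFin (λ e → indicator (e ∈? w)))

  supportCode-injective : ∀ w w′ → supportCode w ≡ supportCode w′ → w ⊆ w′
  supportCode-injective w w′ codes≡ {e} =
    indicator-≡⇒ (e ∈? w) (e ∈? w′)
      (trans (sym (finToFun-funToFin _ e))
             (trans (cong (λ k → finToFun k e) funToFin≡) (finToFun-funToFin _ e)))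
    where
    funToFin≡ = toℕ-injective (trans (sym (toℕ-cast _ _)) (trans (cong toℕ codes≡) (toℕ-cast _ _)))

  supportCode-cong : ∀ {w w′} → w ⊆ w′ → w′ ⊆ w → supportCode w ≡ supportCode w′
  supportCode-cong {w} {w′} w⊆w′ w′⊆w =
    cong (cast _) (funToFin-cong (λ e → indicator-cong (e ∈? w) (e ∈? w′) w⊆w′ w′⊆w))

module Substitution {d : ℕ} (σ : Subst d) where

  Word : Set
  Word = List (Fin d)

  infixr 9 σ^[_]_

  σ^[_]_ : ℕ → Word → Word
  σ^[ n ] w = apply σ ^[ n ] w

  apply-++ : ∀ u v → apply σ (u ++ v) ≡ apply σ u ++ apply σ v
  apply-++ = concatMap-++ σ

  apply-[_] : ∀ y → apply σ [ y ] ≡ σ y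
  apply-[ y ] = ++-identityʳ (σ y)

  σ^-++ : ∀ n u v → σ^[ n ] (u ++ v) ≡ σ^[ n ] u ++ σ^[ n ] v
  σ^-++ zero u v = refl
  σ^-++ (suc n) u v = trans (cong (apply σ) (σ^-++ n u v)) (apply-++ (σ^[ n ] u) (σ^[ n ] v))

  ∈-apply⁺ : ∀ {e y w} → e ∈ σ y → y ∈ w → e ∈ apply σ w
  ∈-apply⁺ e∈σy y∈w = Any.concatMap⁺ σ (lose y∈w e∈σy)

  ∈-apply⁻ : ∀ {e} w → e ∈ apply σ w → ∃ λ y → y ∈ w × e ∈ σ y
  ∈-apply⁻ w e∈ = find (Any.concatMap⁻ σ {xs = w} e∈)

  Adjacent-σ^-inherit : ∀ {p} m n {e c} → Adjacent p (σ^[ m ] [ e ]) → e ∈ σ^[ n ] [ c ] →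
    Adjacent p (σ^[ m + n ] [ c ])
  Adjacent-σ^-inherit {p} m n {e} {c} adj e∈ with ∈-∃++ e∈
  ... | u , v , σⁿc≡u++e∷v =
    subst (Adjacent p) (sym σ^[m+n]c≡) (Adjacent-++⁺ʳ (σ^[ m ] u) (Adjacent-++⁺ˡ (σ^[ m ] v) adj))
    where
    open ≡-Reasoning
    σ^[m+n]c≡ : σ^[ m + n ] [ c ] ≡ σ^[ m ] u ++ σ^[ m ] [ e ] ++ σ^[ m ] v
    σ^[m+n]c≡ = begin
      σ^[ m + n ] [ c ]                        ≡⟨ ^[+] (apply σ) m n [ c ] ⟩
      σ^[ m ] (σ^[ n ] [ c ])                  ≡⟨ cong σ^[ m ]_ σⁿc≡u++e∷v ⟩
      σ^[ m ] (u ++ [ e ] ++ v)                ≡⟨ σ^-++ m u _ ⟩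
      σ^[ m ] u ++ σ^[ m ] ([ e ] ++ v)        ≡⟨ cong (σ^[ m ] u ++_) (σ^-++ m [ e ] v) ⟩
      σ^[ m ] u ++ σ^[ m ] [ e ] ++ σ^[ m ] v  ∎

  incidence^-pos⇒∈ : ∀ n {e c} → 0 < powMat (incidence σ) n e c → e ∈ σ^[ n ] [ c ]
  incidence^-pos⇒∈ zero {e} {c} pos with idMat-pos⇒≡ e c pos
  ... | refl = here refl
  incidence^-pos⇒∈ (suc n) pos with sum-tabulate-pos⇒pos _ pos
  ... | k , pos′ with *-pos⇒pos _ _ pos′
  ...   | e∈σk , k∈ = ∈-apply⁺ (count-pos⇒∈ (σ k) e∈σk) (incidence^-pos⇒∈ n k∈)

  NonErasing : Set
  NonErasing = ∀ y → σ y ≢ []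

  module NonErasingSubstitution (σ-nonErasing : NonErasing) where

    headσ : Fin d → Fin d
    headσ y with σ y | σ-nonErasing y
    ... | [] | σy≢[] = ⊥-elim (σy≢[] refl)
    ... | a ∷ _ | _ = a

    lastσ : Fin d → Fin d
    lastσ y with σ y | σ-nonErasing y
    ... | w | w≢[] with initLast w
    ...   | [] = ⊥-elim (w≢[] refl)
    ...   | _ ∷ʳ′ a = a

    σ≡headσ∷ : ∀ y → ∃ λ v → σ y ≡ headσ y ∷ v
    σ≡headσ∷ y with σ y | σ-nonErasing y
    ... | [] | σy≢[] = ⊥-elim (σy≢[] refl)
    ... | a ∷ v | _ = v , refl

    σ≡∷ʳlastσ : ∀ y → ∃ λ u → σ y ≡ u ∷ʳ lastσ y
    σ≡∷ʳlastσ y with σ y | σ-nonErasing y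
    ... | w | w≢[] with initLast w
    ...   | [] = ⊥-elim (w≢[] refl)
    ...   | u ∷ʳ′ a = u , refl

    headσ∈σ : ∀ y → headσ y ∈ σ y
    headσ∈σ y = subst (headσ y ∈_) (sym (proj₂ (σ≡headσ∷ y))) (here refl)

    lastσ∈σ : ∀ y → lastσ y ∈ σ y
    lastσ∈σ y = subst (lastσ y ∈_) (sym (proj₂ (σ≡∷ʳlastσ y))) (∈-++⁺ʳ _ (here refl))

    length≤length-apply : ∀ w → length w ≤ length (apply σ w)
    length≤length-apply [] = z≤n
    length≤length-apply (y ∷ w) =
      ≤-trans (+-mono-≤ 1≤|σy| (length≤length-apply w)) (≤-reflexive (sym (length-++ (σ y))))
      where
      1≤|σy| : 1 ≤ length (σ y)
      1≤|σy| = subst (λ v → 1 ≤ length v) (sym (proj₂ (σ≡headσ∷ y))) (s≤s z≤n)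

    junction : Fin d × Fin d → Fin d × Fin d
    junction (y , z) = lastσ y , headσ z

    Adjacent-junction : ∀ y z → Adjacent (junction (y , z)) (σ y ++ σ z)
    Adjacent-junction y z with σ≡∷ʳlastσ y | σ≡headσ∷ z
    ... | u , σy≡ | v , σz≡ =
      subst₂ (λ s t → Adjacent (junction (y , z)) (s ++ t)) (sym σy≡) (sym σz≡) (u , v , ++-assoc u _ _)

    Adjacent-apply⁺ : ∀ {q w} → Adjacent q w → Adjacent (junction q) (apply σ w)
    Adjacent-apply⁺ {y , z} (u , v , refl) =
      subst (Adjacent (junction (y , z))) (sym apply-split)
        (Adjacent-++⁺ʳ (apply σ u) (Adjacent-++⁺ˡ (apply σ v) (Adjacent-junction y z)))
      where
      apply-split : apply σ (u ++ y ∷ z ∷ v) ≡ apply σ u ++ (σ y ++ σ z) ++ apply σ v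
      apply-split = trans (apply-++ u (y ∷ z ∷ v))
                          (cong (apply σ u ++_) (sym (++-assoc (σ y) (σ z) (apply σ v))))

    Adjacent-apply⁻ : ∀ w {a b} → Adjacent (a , b) (apply σ w) →
      (∃ λ y → y ∈ w × Adjacent (a , b) (σ y)) ⊎ (∃ λ q → Adjacent q w × (a , b) ≡ junction q)
    Adjacent-apply⁻ [] adj with () ← Adjacent⇒2≤length adj
    Adjacent-apply⁻ (y ∷ w) adj with Adjacent-++⁻ (σ y) adj
    ... | inj₁ adj′ = inj₁ (y , here refl , adj′)
    ... | inj₂ (inj₂ ((u , σy≡u∷ʳa) , (v , σw≡b∷v))) = inj₂ (junction-at w σy≡u∷ʳa σw≡b∷v)
      where
      junction-at : ∀ {a b u v} w → σ y ≡ u ∷ʳ a → apply σ w ≡ b ∷ v →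
                    ∃ λ q → Adjacent q (y ∷ w) × (a , b) ≡ junction q
      junction-at [] _ ()
      junction-at {u = u} (z ∷ w) σy≡ σzw≡ with σ≡∷ʳlastσ y | σ≡headσ∷ z
      ... | u′ , σy≡′ | v′ , σz≡ =
        (y , z) , ([] , w , refl) ,
        cong₂ _,_ (∷ʳ-injectiveʳ u u′ (trans (sym σy≡) σy≡′))
                  (proj₁ (∷-injective (trans (sym σzw≡) (cong (_++ apply σ w) σz≡))))
    ... | inj₂ (inj₁ adj′) with Adjacent-apply⁻ w adj′
    ...   | inj₁ (y′ , y′∈w , adj″) = inj₁ (y′ , there y′∈w , adj″)
    ...   | inj₂ (q , adj″ , eq) = inj₂ (q , Adjacent-++⁺ʳ [ y ] adj″ , eq)

    Adjacent-σ^⁻ : ∀ n {c p} → Adjacent p (σ^[ n ] [ c ]) →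
      ∃ λ e → ∃ λ t → ∃ λ q → Adjacent q (σ e) × p ≡ junction ^[ t ] q
    Adjacent-σ^⁻ zero adj with s≤s () ← Adjacent⇒2≤length adj
    Adjacent-σ^⁻ (suc n) {c} adj with Adjacent-apply⁻ (σ^[ n ] [ c ]) adj
    ... | inj₁ (e , _ , adj′) = e , 0 , _ , adj′ , refl
    ... | inj₂ (q , adj′ , p≡jq) with Adjacent-σ^⁻ n adj′
    ...   | e , t , q′ , adj″ , q≡ = e , suc t , q′ , adj″ , trans p≡jq (cong junction q≡)

    Adjacent-σ^⁺ : ∀ t {e q} → Adjacent q (σ e) → Adjacent (junction ^[ t ] q) (σ^[ suc t ] [ e ])
    Adjacent-σ^⁺ zero {e} adj = subst (Adjacent _) (sym apply-[ e ]) adj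
    Adjacent-σ^⁺ (suc t) adj = Adjacent-apply⁺ (Adjacent-σ^⁺ t adj)

  Full : Word → Set
  Full w = ∀ e → e ∈ w

  module Primitivity (prim : Primitive σ) where

    σ^-full : ∀ c → Full (σ^[ suc (proj₁ prim) ] [ c ])
    σ^-full c e = incidence^-pos⇒∈ (suc (proj₁ prim)) (proj₂ prim e c)

    nonErasing : NonErasing
    nonErasing y σy≡[] = ∉[] (subst (y ∈_) (erased (proj₁ prim)) (σ^-full y y))
      where
      erased : ∀ n → σ^[ suc n ] [ y ] ≡ []
      erased zero = trans apply-[ y ] σy≡[]
      erased (suc n) = cong (apply σ) (erased n)

    open NonErasingSubstitution nonErasing public

    ∈-image : ∀ e → ∃ λ y → e ∈ σ y
    ∈-image e = map₂ proj₂ (∈-apply⁻ (σ^[ proj₁ prim ] [ e ]) (σ^-full e e))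

    Full-apply : ∀ {w} → Full w → Full (apply σ w)
    Full-apply full e with y , e∈σy ← ∈-image e = ∈-apply⁺ e∈σy (full y)

    Full-σ^ : ∀ r {w} → Full w → Full (σ^[ r ] w)
    Full-σ^ zero full = full
    Full-σ^ (suc r) full = Full-apply (Full-σ^ r full)

    σ^-nonempty : ∀ n c → ∃ λ y → y ∈ σ^[ n ] [ c ]
    σ^-nonempty zero c = c , here refl
    σ^-nonempty (suc n) c with y , y∈ ← σ^-nonempty n c = headσ y , ∈-apply⁺ (headσ∈σ y) y∈

    full-at-2^d∸2 : ∀ c → Full (σ^[ 2 ^ d ∸ 2 ] [ c ])
    full-at-2^d∸2 c =
      full-from (attained-before-avoiding κ (supportCode {d} []) ∅≢κ (λ {i} {j} → κ-step {i} {j})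
                                          (suc (proj₁ prim)))
      where
      κ : ℕ → Fin (suc (2 ^ d ∸ 1))
      κ n = supportCode (σ^[ n ] [ c ])
      ∅≢κ : ∀ n → supportCode {d} [] ≢ κ n
      ∅≢κ n ∅≡κn = ∉[] (supportCode-injective (σ^[ n ] [ c ]) [] (sym ∅≡κn) (proj₂ (σ^-nonempty n c)))
      κ-step : ∀ {i j} → κ i ≡ κ j → κ (suc i) ≡ κ (suc j)
      κ-step {i} {j} κi≡κj =
        supportCode-cong (⊆.concatMap⁺ σ (supportCode-injective (σ^[ i ] [ c ]) _ κi≡κj))
                         (⊆.concatMap⁺ σ (supportCode-injective (σ^[ j ] [ c ]) _ (sym κi≡κj)))
      K = 2 ^ d ∸ 2
      full-from : (∃ λ t → t < 2 ^ d ∸ 1 × κ t ≡ κ (suc (proj₁ prim))) → Full (σ^[ K ] [ c ])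
      full-from (t , t<2^d∸1 , κt≡) =
        subst (λ n → Full (σ^[ n ] [ c ])) (m∸n+n≡m t≤K)
          (subst Full (sym (^[+] (apply σ) (K ∸ t) t [ c ])) (Full-σ^ (K ∸ t) fullₜ))
        where
        t≤K : t ≤ K
        t≤K = ≤-trans (<⇒≤pred t<2^d∸1) (≤-reflexive (∸-+-assoc (2 ^ d) 1 1))
        fullₜ : Full (σ^[ t ] [ c ])
        fullₜ e = supportCode-injective (σ^[ suc (proj₁ prim) ] [ c ]) _ (sym κt≡) (σ^-full c e)

  σ^-[] : ∀ n → σ^[ n ] [] ≡ []
  σ^-[] zero = refl
  σ^-[] (suc n) = cong (apply σ) (σ^-[] n)

  length-apply≤ : ∀ w → length (apply σ w) ≤ size σ * length w
  length-apply≤ [] = z≤n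
  length-apply≤ (y ∷ w) =
    ≤-trans (≤-reflexive (length-++ (σ y)))
      (≤-trans (+-mono-≤ (≤-foldr-⊔-tabulate (length ∘ σ) y) (length-apply≤ w))
               (≤-reflexive (sym (*-suc (size σ) (length w)))))

  length-σ^≤ : ∀ n c → length (σ^[ n ] [ c ]) ≤ size σ ^ n
  length-σ^≤ zero c = ≤-refl
  length-σ^≤ (suc n) c = ≤-trans (length-apply≤ (σ^[ n ] [ c ])) (*-monoʳ-≤ (size σ) (length-σ^≤ n c))

  module FixedPointWord (x : InfWord d) (fix : FixedPoint σ x) where

    IsPrefix : Word → Set
    IsPrefix w = w ≡ pref x (length w)

    apply-IsPrefix : ∀ {w} → IsPrefix w → IsPrefix (apply σ w)
    apply-IsPrefix {w} w≡ = subst (λ v → IsPrefix (apply σ v)) (sym w≡) (fix (length w))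

    σ^-pref : ∀ n m → IsPrefix (σ^[ n ] (pref x m))
    σ^-pref zero m = cong (pref x) (sym (length-applyUpTo x m))
    σ^-pref (suc n) m = apply-IsPrefix (σ^-pref n m)

    module Blocks {N : ℕ} {a b : Fin d} (uniform : ∀ c → Adjacent (a , b) (σ^[ N ] [ c ])) where

      B : ℕ → ℕ
      B m = length (σ^[ N ] (pref x m))

      block : ℕ → Word
      block m = σ^[ N ] [ x m ]

      pref-B-suc : ∀ m → pref x (B (suc m)) ≡ pref x (B m) ++ block m
      pref-B-suc m = begin
        pref x (B (suc m))                 ≡⟨ sym (σ^-pref N (suc m)) ⟩
        σ^[ N ] (pref x (suc m))           ≡⟨ cong σ^[ N ]_ (pref-suc x m) ⟩
        σ^[ N ] (pref x m ++ [ x m ])      ≡⟨ σ^-++ N (pref x m) [ x m ] ⟩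
        σ^[ N ] (pref x m) ++ block m      ≡⟨ cong (_++ block m) (σ^-pref N m) ⟩
        pref x (B m) ++ block m            ∎
        where open ≡-Reasoning

      length-pref-B-++ : ∀ m u → length (pref x (B m) ++ u) ≡ B m + length u
      length-pref-B-++ m u =
        trans (length-++ (pref x (B m))) (cong (_+ length u) (length-applyUpTo x (B m)))

      B-suc : ∀ m → B (suc m) ≡ B m + length (block m)
      B-suc m = trans (sym (length-applyUpTo x (B (suc m))))
                      (trans (cong length (pref-B-suc m)) (length-pref-B-++ m (block m)))

      B-< : ∀ m → B m < B (suc m)
      B-< m =
        subst (B m <_) (sym (B-suc m)) (m<m+n (B m) (<-≤-trans 0<2 (Adjacent⇒2≤length (uniform (x m)))))
        where
        0<2 : 0 < 2
        0<2 = s≤s z≤n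

      occurrence-in-block : ∀ m → ∃ λ k → B m ≤ k × k < B (suc m) × OccursAt x a b k
      occurrence-in-block m with u , v , block≡ ← uniform (x m) =
        B m + length u , m≤m+n (B m) (length u) , k<Bm+1 ,
        subst (OccursAt x a b) (length-pref-B-++ m u) (pref≡⇒OccursAt x (pref x (B m) ++ u) pref≡)
        where
        pref≡ : pref x (B (suc m)) ≡ (pref x (B m) ++ u) ++ a ∷ b ∷ v
        pref≡ = trans (pref-B-suc m)
                      (trans (cong (pref x (B m) ++_) block≡) (sym (++-assoc (pref x (B m)) u _)))
        |u|<|block| : length u < length (block m)
        |u|<|block| =
          subst (length u <_) (sym (trans (cong length block≡) (length-++ u))) (m<m+n (length u) (s≤s z≤n))
        k<Bm+1 : B m + length u < B (suc m)
        k<Bm+1 = subst (B m + length u <_) (sym (B-suc m)) (+-monoʳ-< (B m) |u|<|block|)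

      B-suc-suc≤ : ∀ {m i} → B m ≤ i → B (suc (suc m)) ≤ i + 2 * size σ ^ N
      B-suc-suc≤ {m} {i} Bm≤i = begin
        B (suc (suc m))
          ≡⟨ trans (B-suc (suc m)) (cong (_+ length (block (suc m))) (B-suc m)) ⟩
        B m + length (block m) + length (block (suc m))
          ≤⟨ +-mono-≤ (+-mono-≤ Bm≤i (length-σ^≤ N (x m))) (length-σ^≤ N (x (suc m))) ⟩
        i + L^N + L^N
          ≡⟨ trans (+-assoc i L^N L^N) (cong (λ n → i + (L^N + n)) (sym (+-identityʳ L^N))) ⟩
        i + 2 * L^N ∎
        where
        open ≤-Reasoning
        L^N = size σ ^ N

      next-occurrence : ∀ i → ∃ λ k → i < k × k ≤ i + 2 * size σ ^ N × OccursAt x a b k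
      next-occurrence i = in-next-block (interval-containing B (cong length (σ^-[] N)) B-< i)
        where
        in-next-block : (∃ λ m → B m ≤ i × i < B (suc m)) →
                        ∃ λ k → i < k × k ≤ i + 2 * size σ ^ N × OccursAt x a b k
        in-next-block (m , Bm≤i , i<Bm+1) =
          let k , Bm+1≤k , k<Bm+2 , occ = occurrence-in-block (suc m)
          in k , <-≤-trans i<Bm+1 Bm+1≤k , ≤-trans (<⇒≤ k<Bm+2) (B-suc-suc≤ Bm≤i) , occ

    return-time-bound : ∀ {N E a b} → N ≤ E → (∀ c → Adjacent (a , b) (σ^[ N ] [ c ])) →
      ∀ {i j} → (∀ k → i < k → k < j → ¬ OccursAt x a b k) → j ∸ i ≤ 2 * size σ ^ E
    return-time-bound {N} {E} N≤E uniform {i} {j} no-occurrence =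
      let k , i<k , k≤ , occ = Blocks.next-occurrence {N} uniform i
          j≤k = ≮⇒≥ (λ k<j → no-occurrence k i<k k<j occ)
      in begin
        j ∸ i                ≤⟨ ∸-monoˡ-≤ i j≤k ⟩
        k ∸ i                ≤⟨ m≤n+o⇒m∸n≤o k i k≤ ⟩
        2 * size σ ^ N       ≤⟨ *-monoʳ-≤ 2 (^-monoʳ-≤-from-2≤ (size σ) 2≤L^N N≤E) ⟩
        2 * size σ ^ E       ∎
      where
      open ≤-Reasoning
      2≤L^N : 2 ≤ size σ ^ N
      2≤L^N = ≤-trans (Adjacent⇒2≤length (uniform (x 0))) (length-σ^≤ N (x 0))

  module PrimitiveFixedPoint (prim : Primitive σ) (x : InfWord d) (fix : FixedPoint σ x)
                             {e : Fin d} (e≢x0 : e ≢ x 0) where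
    open Primitivity prim
    open FixedPointWord x fix

    headσ-x0 : headσ (x 0) ≡ x 0
    headσ-x0 =
      proj₁ (∷-injective (subst IsPrefix (trans apply-[ x 0 ] (proj₂ (σ≡headσ∷ (x 0)))) (fix 1)))

    σ-x0 : ∃ λ r → σ (x 0) ≡ x 0 ∷ r × r ≢ []
    σ-x0 = r , σx0≡ , r≢[]
      where
      r = proj₁ (σ≡headσ∷ (x 0))
      σx0≡ : σ (x 0) ≡ x 0 ∷ r
      σx0≡ = trans (proj₂ (σ≡headσ∷ (x 0))) (cong (_∷ r) headσ-x0)
      r≢[] : r ≢ []
      r≢[] r≡[] = e≢x0 (x0-only (suc (proj₁ prim)) (σ^-full (x 0) e))
        where
        x0-only : ∀ n {y} → y ∈ σ^[ n ] [ x 0 ] → y ≡ x 0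
        x0-only zero (here y≡x0) = y≡x0
        x0-only (suc n) y∈ with z , z∈ , y∈σz ← ∈-apply⁻ (σ^[ n ] [ x 0 ]) y∈ with refl ← x0-only n z∈
          with here y≡x0 ← subst (_ ∈_) (trans σx0≡ (cong (x 0 ∷_) r≡[])) y∈σz = y≡x0

    σ^-x0-grows : ∀ n → ∃ λ w → σ^[ n ] [ x 0 ] ≡ x 0 ∷ w × n ≤ length w
    σ^-x0-grows zero = [] , refl , z≤n
    σ^-x0-grows (suc n) =
      let w , σⁿx0≡ , n≤|w| = σ^-x0-grows n
          r , σx0≡ , r≢[] = σ-x0
      in r ++ apply σ w ,
         trans (cong (apply σ) σⁿx0≡) (cong (_++ apply σ w) σx0≡) ,
         ≤-trans (+-mono-≤ (nonempty⇒1≤length r≢[]) (≤-trans n≤|w| (length≤length-apply w)))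
                 (≤-reflexive (sym (length-++ r)))
      where
      nonempty⇒1≤length : ∀ {r : Word} → r ≢ [] → 1 ≤ length r
      nonempty⇒1≤length {[]} r≢[] = ⊥-elim (r≢[] refl)
      nonempty⇒1≤length {_ ∷ _} _ = s≤s z≤n

    Adjacent-σ^-x0 : ∀ i → Adjacent (x i , x (suc i)) (σ^[ suc i ] [ x 0 ])
    Adjacent-σ^-x0 i =
      let w , σ^x0≡ , i+1≤|w| = σ^-x0-grows (suc i)
      in subst (Adjacent (x i , x (suc i))) (sym (σ^-pref (suc i) 1))
           (Adjacent-pref x i (≤-trans (s≤s i+1≤|w|) (≤-reflexive (cong length (sym σ^x0≡)))))

    digram-origin : ∀ i →
      ∃ λ e → ∃ λ t → ∃ λ q → Adjacent q (σ e) × (x i , x (suc i)) ≡ junction ^[ t ] q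
    digram-origin i = Adjacent-σ^⁻ (suc i) (Adjacent-σ^-x0 i)

    uniform-level : ∀ i →
      ∃ λ N → N ≤ d * d + (2 ^ d ∸ 2) × ∀ c → Adjacent (x i , x (suc i)) (σ^[ N ] [ c ])
    uniform-level i =
      let e , t , q , adj , xᵢ≡ = digram-origin i
          κ = λ n → pairCode (junction ^[ n ] q)
          t′ , t′<d*d , κt′≡κt = attained-before κ (cong pairCode ∘ cong junction ∘ pairCode-injective) t
          K = 2 ^ d ∸ 2
      in suc t′ + K , +-monoˡ-≤ K t′<d*d ,
         λ c → subst (λ p → Adjacent p (σ^[ suc t′ + K ] [ c ]))
                     (trans (pairCode-injective κt′≡κt) (sym xᵢ≡))
                     (Adjacent-σ^-inherit (suc t′) K (Adjacent-σ^⁺ t′ adj) (full-at-2^d∸2 c e))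

module TwoLetters (σ : Subst 2) (prim : Primitive σ) (x : InfWord 2) (fix : FixedPoint σ x) where
  open Substitution σ
  open Primitivity prim
  open PrimitiveFixedPoint prim x fix (proj₂ (other-letter (x 0)))
  open DecMembership (_≟_ {2}) using (_∈?_)

  junction-cubic : ∀ p → junction (junction (junction p)) ≡ junction p
  junction-cubic (a , b) = cong₂ _,_ (Fin2-g∘g-fixes-image lastσ refl) (Fin2-g∘g-fixes-image headσ refl)

  -- As σ²(c) is full, e ∈ σ(y) for some y ∈ σ(c), where y ≢ e; if also c ≢ e, then y ≡ c.
  ∉σ⇒≡ : ∀ {c e} → ¬ e ∈ σ c → c ≡ e
  ∉σ⇒≡ {c} {e} e∉σc with c ≟ e
  ... | yes c≡e = c≡e
  ... | no c≢e =
    let y , y∈σc , e∈σy = ∈-apply⁻ (apply σ [ c ]) (full-at-2^d∸2 c e)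
        y∈σc′ = subst (y ∈_) apply-[ c ] y∈σc
        y≢e = λ y≡e → e∉σc (subst (_∈ σ c) y≡e y∈σc′)
    in ⊥-elim (e∉σc (subst (λ z → e ∈ σ z) (Fin2-≢-unique y≢e c≢e) e∈σy))

  junction²-fixes : ∀ {c e q} → ¬ e ∈ σ c → Adjacent q (σ e) → junction (junction q) ≡ q
  junction²-fixes {c} {e} {u , v} e∉σc adj =
    cong₂ _,_ (Fin2-g∘g-fixes-image lastσ {u} {e} (Fin2-≢-unique (≢e (lastσ∈σ e)) u≢e))
              (Fin2-g∘g-fixes-image headσ {v} {x 0} (trans headσ-x0 (Fin2-≢-unique x0≢e v≢e)))
    where
    e∉σe : ¬ e ∈ σ e
    e∉σe = subst (λ z → ¬ e ∈ σ z) (∉σ⇒≡ e∉σc) e∉σc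
    ≢e : ∀ {y} → y ∈ σ e → y ≢ e
    ≢e y∈ refl = e∉σe y∈
    u≢e : u ≢ e
    u≢e = ≢e (proj₁ (Adjacent⇒∈ adj))
    v≢e : v ≢ e
    v≢e = ≢e (proj₂ (Adjacent⇒∈ adj))
    x0≢e : x 0 ≢ e
    x0≢e x0≡e = ≢e (headσ∈σ e) (trans (cong headσ (sym x0≡e)) (trans headσ-x0 x0≡e))

  -- The digram is q, junction q or junction² q for a digram q of some σ(e); the last case
  -- reduces to the first when e ∉ σ(c).
  level-four : ∀ i c → Adjacent (x i , x (suc i)) (σ^[ 4 ] [ c ])
  level-four i c =
    let e , t , q , adj , xᵢ≡ = digram-origin i
    in subst At4 (sym xᵢ≡) (from-origin t adj)
    where
    At4 : Fin 2 × Fin 2 → Set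
    At4 p = Adjacent p (σ^[ 4 ] [ c ])
    after-two-junctions : ∀ {e q} → Adjacent q (σ e) → Dec (e ∈ σ^[ 1 ] [ c ]) →
                          At4 (junction (junction q))
    after-two-junctions adj (yes e∈) = Adjacent-σ^-inherit 3 1 (Adjacent-σ^⁺ 2 adj) e∈
    after-two-junctions {e} adj (no e∉) =
      subst At4 (sym (junction²-fixes (e∉ ∘ subst (e ∈_) (sym apply-[ c ])) adj))
        (Adjacent-σ^-inherit 1 3 (Adjacent-σ^⁺ 0 adj) (Full-apply (full-at-2^d∸2 c) e))
    from-origin : ∀ t {e q} → Adjacent q (σ e) → At4 (junction ^[ t ] q)
    from-origin zero {e} adj =
      Adjacent-σ^-inherit 1 3 (Adjacent-σ^⁺ 0 adj) (Full-apply (full-at-2^d∸2 c) e)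
    from-origin (suc t) {e} {q} adj = by-parity (^[suc]-of-cubic junction junction-cubic t q)
      where
      by-parity : junction ^[ suc t ] q ≡ junction q ⊎ junction ^[ suc t ] q ≡ junction (junction q) →
                  At4 (junction ^[ suc t ] q)
      by-parity (inj₁ eq) =
        subst At4 (sym eq) (Adjacent-σ^-inherit 2 2 (Adjacent-σ^⁺ 1 adj) (full-at-2^d∸2 c e))
      by-parity (inj₂ eq) = subst At4 (sym eq) (after-two-junctions adj (e ∈? σ^[ 1 ] [ c ]))

square+2^∸2≤ : ∀ d → 3 ≤ d → d * d + (2 ^ d ∸ 2) ≤ (d ∸ 1) * d ^ d
square+2^∸2≤ d@(suc (suc (suc n))) _ = begin
  d * d + (2 ^ d ∸ 2)  ≤⟨ +-mono-≤ d*d≤dᵈ (≤-trans (m∸n≤m (2 ^ d) 2) (^-monoˡ-≤ d 2≤d)) ⟩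
  d ^ d + d ^ d        ≡⟨ cong (d ^ d +_) (sym (+-identityʳ (d ^ d))) ⟩
  2 * d ^ d            ≤⟨ *-monoˡ-≤ (d ^ d) 2≤d∸1 ⟩
  (d ∸ 1) * d ^ d      ∎
  where
  open ≤-Reasoning
  2≤d : 2 ≤ d
  2≤d = s≤s (s≤s z≤n)
  2≤d∸1 : 2 ≤ d ∸ 1
  2≤d∸1 = s≤s (s≤s z≤n)
  d*d≤dᵈ : d * d ≤ d ^ d
  d*d≤dᵈ = ≤-trans (≤-reflexive (cong (d *_) (sym (*-identityʳ d)))) (^-monoʳ-≤ d 2≤d)
square+2^∸2≤ 1 (s≤s ())
square+2^∸2≤ 2 (s≤s (s≤s ()))

one-letter-gap : ∀ (x : InfWord 1) {a b i j} → (∀ k → i < k → k < j → ¬ OccursAt x a b k) → j ∸ i ≤ 1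
one-letter-gap x {a} {b} {i} {j} no-occurrence =
  m≤n+o⇒m∸n≤o j i (≤-trans (≮⇒≥ (λ i+1<j → no-occurrence (suc i) ≤-refl i+1<j occurs))
                            (≤-reflexive (+-comm 1 i)))
  where
  occurs : OccursAt x a b (suc i)
  occurs = Fin1-unique _ _ , Fin1-unique _ _

lemma2p6 : (d : ℕ) (σ : Subst d) → Primitive σ →
    (x : InfWord d) → FixedPoint σ x →
    (a b : Fin d) (i j : ℕ) → i < j →
    OccursAt x a b i → OccursAt x a b j →
    (∀ k → i < k → k < j → ¬ OccursAt x a b k) →
    j ∸ i ≤ 2 * size σ ^ ((d ∸ 1) * d ^ d)
lemma2p6 zero _ _ _ _ () _ _ _ _ _ _ _
lemma2p6 1 _ _ x _ _ _ _ _ _ _ _ gap = ≤-trans (one-letter-gap x gap) (s≤s z≤n)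
lemma2p6 2 σ prim x fix _ _ i _ _ (refl , refl) _ gap =
  return-time-bound {N = 4} ≤-refl (TwoLetters.level-four σ prim x fix i) gap
  where open Substitution.FixedPointWord σ x fix
lemma2p6 d@(suc (suc (suc _))) σ prim x fix _ _ i _ _ (refl , refl) _ gap =
  let N , N≤ , uniform = uniform-level i
  in return-time-bound (≤-trans N≤ (square+2^∸2≤ d (s≤s (s≤s (s≤s z≤n))))) uniform gap
  where
  open Substitution σ
  open FixedPointWord x fix
  open PrimitiveFixedPoint prim x fix (proj₂ (other-letter (x 0)))
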